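{- Let $\mathcal{N}$ be a near hexagon of order $(2,t)$ and let $\mathcal{H}$ be a full subgeometry of $\mathcal{N}$ isomorphic to $H(2)$ and isometrically embedded in $\mathcal{N}$. Then every point of $\mathcal{N}$ is at distance at most $2$ from $\mathcal{H}$. Moreover, points of $\mathcal{H}$ have Type A (classical); points at distance $1$ from $\mathcal{H}$ have Type $B_i$ for some $i\in\{1,2,3,4,5\}$; points at distance $2$ from $\mathcal{H}$ have Type C (ovoidal).
   Context: A near hexagon is a partial linear space whose collinearity graph is connected of diameter $3$ such that for every point $x$ and line $L$ there is a unique point on $L$ nearest to $x$; order $(2,t)$ means three points per line and $t+1$ lines through each point ($t$ possibly infinite). Full: every point of $\mathcal{N}$ on a line of $\mathcal{H}$ lies in $\mathcal{H}$; isometrically embedded: distances agree. $H(2)$ is the split Cayley hexagon of order $2$ (63 points). A valuation of $\mathcal{H}$ is a map $f$ from the points of $\mathcal{H}$ to $\mathbb{Z}$ with minimum $0$ such that each line has a unique point of minimal $f$-value and its other points have value one larger; $M_f=\max f$, $\mathcal{O}_f=f^{ -1}(0)$. For a point $x$ of $\mathcal{N}$, $f_x(y)=\mathrm{d}(x,y)-\mathrm{d}(x,\mathcal{H})$ for $y$ in $\mathcal{H}$; the type of $x$ is the type of $f_x$. Types: A = classical valuations $y\mapsto\mathrm{d}(y,p)$; $B_1,B_2,B_3,B_4,B_5$ = valuations with $M_f=2$ and $|\mathcal{O}_f|=1,3,4,7,9$ respectively; C = ovoidal valuations, i.e. $M_f=1$ (so $\mathcal{O}_f$ meets every line in one point;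 here $|\mathcal{O}_f|=21$). -}

module Defs where

open import Level using (0ℓ)
open import Data.Bool using (Bool; true; false; _∧_; _∨_; _xor_; not; T)
open import Data.Nat using (ℕ; zero; suc; _≤_; _<_; _⊓_; _⊔_; _≟_)
open import Data.Fin using (Fin)
open import Data.Vec using (Vec; []; _∷_; zipWith)
open import Data.List using (List; []; _∷_; map; concatMap; mapMaybe; filter; length; foldr)
open import Data.Maybe using (Maybe; just; nothing)
open import Data.Product using (Σ; Σ-syntax; _×_; _,_; proj₁)
open import Data.Sum using (_⊎_)
open import Relation.Nullary using (¬_; yes; no)
open import Relation.Nullary.Decidable using (T?)
open import Relation.Binary.PropositionalEquality using (_≡_; _≢_)
open import Function.Bundles using (_↔_)

data Walk {A : Set} (R : A → A → Set) : A → A → ℕ → Set where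
  here  : ∀ {x} → Walk R x x zero
  there : ∀ {x y z n} → R x y → Walk R y z n → Walk R x z (suc n)

IsDist : {A : Set} (R : A → A → Set) → A → A → ℕ → Set
IsDist R x y n = Walk R x y n × (∀ m → Walk R x y m → n ≤ m)

record Geometry : Set₁ where
  field
    Point : Set
    Line  : Set
    pt    : Line → Fin 3 → Point

module _ (G : Geometry) where
  open Geometry G

  On : Point → Line → Set
  On x L = Σ (Fin 3) λ i → pt L i ≡ x

  Col : Point → Point → Set
  Col x y = Σ Line λ L → On x L × On y L

-- A near hexagon of order (2,t): lines have exactly three points, it is a
-- partial linear space, every point lies on t+1 lines where t+1 is the
-- cardinality of the (arbitrary, possibly infinite) set LinesIdx,
-- the collinearity graph is connected of diameter 3 (d is its distance
-- function), and each line has a unique point nearest to any given point.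
record IsNearHexagon (G : Geometry) : Set₁ where
  open Geometry G
  field
    pt-injective : ∀ L (i j : Fin 3) → pt L i ≡ pt L j → i ≡ j
    partial-linear : ∀ (L M : Line) (x y : Point) → x ≢ y →
                     On G x L → On G y L → On G x M → On G y M → L ≡ M
    LinesIdx : Set
    lines-through : ∀ (x : Point) → (Σ Line (On G x)) ↔ LinesIdx
    d : Point → Point → ℕ
    d-is-distance : ∀ x y → IsDist (Col G) x y (d x y)
    diam-≤3 : ∀ x y → d x y ≤ 3
    diam-=3 : Σ Point λ x → Σ Point λ y → d x y ≡ 3
    nearest : ∀ (x : Point) (L : Line) →
              Σ (Fin 3) λ i → ∀ (j : Fin 3) → j ≢ i → d x (pt L i) < d x (pt L j)

-- The split Cayley hexagon H(2), in Tits' standard embedding in the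
-- parabolic quadric Q(6,2) : X0 X4 + X1 X5 + X2 X6 = X3^2 of PG(6,2).
-- Points: all 63 points of Q(6,2) (nonzero vectors of F2^7 on the quadric).
-- Lines: the lines of Q(6,2) whose Grassmann coordinates p_ij = x_i y_j - x_j y_i
-- satisfy p12 = p34, p54 = p32, p20 = p35, p65 = p30, p01 = p36, p46 = p31.
-- (Over F2, + = xor, * = ∧, and signs are irrelevant.)

V7 : Set
V7 = Vec Bool 7

nonzero : ∀ {n} → Vec Bool n → Bool
nonzero []       = false
nonzero (b ∷ v)  = b ∨ nonzero v

veq : ∀ {n} → Vec Bool n → Vec Bool n → Bool
veq []      []      = true
veq (a ∷ v) (b ∷ w) = not (a xor b) ∧ veq v w

vadd : V7 → V7 → V7
vadd = zipWith _xor_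

quadForm : V7 → Bool
quadForm (x0 ∷ x1 ∷ x2 ∷ x3 ∷ x4 ∷ x5 ∷ x6 ∷ []) =
  (x0 ∧ x4) xor (x1 ∧ x5) xor (x2 ∧ x6) xor x3

isQPoint : V7 → Bool
isQPoint v = nonzero v ∧ not (quadForm v)

grass : V7 → V7 → Fin 7 → Fin 7 → Bool
grass x y i j = (Data.Vec.lookup x i ∧ Data.Vec.lookup y j) xor (Data.Vec.lookup x j ∧ Data.Vec.lookup y i)
  where import Data.Vec

beq : Bool → Bool → Bool
beq a b = not (a xor b)

titsEquations : V7 → V7 → Bool
titsEquations x y =
  beq (p 1 2) (p 3 4) ∧ beq (p 5 4) (p 3 2) ∧ beq (p 2 0) (p 3 5) ∧
  beq (p 6 5) (p 3 0) ∧ beq (p 0 1) (p 3 6) ∧ beq (p 4 6) (p 3 1)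
  where
    open import Data.Fin using (#_)
    p : ℕ → ℕ → Bool
    p i j = grass x y (fin i) (fin j)
      where
        fin : ℕ → Fin 7
        fin 0 = # 0
        fin 1 = # 1
        fin 2 = # 2
        fin 3 = # 3
        fin 4 = # 4
        fin 5 = # 5
        fin _ = # 6

isHLine : V7 → V7 → V7 → Bool
isHLine a b c =
  not (veq a b) ∧ veq c (vadd a b) ∧
  isQPoint a ∧ isQPoint b ∧ isQPoint c ∧ titsEquations a b

HPoint : Set
HPoint = Σ V7 λ v → T (isQPoint v)

HLine : HPoint → HPoint → HPoint → Set
HLine a b c = T (isHLine (proj₁ a) (proj₁ b) (proj₁ c))

HCol : HPoint → HPoint → Set
HCol a b = Σ HPoint λ c → HLine a b c

allV : (n : ℕ) → List (Vec Bool n)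
allV zero    = [] ∷ []
allV (suc n) = concatMap (λ v → (false ∷ v) ∷ (true ∷ v) ∷ []) (allV n)

toHPoint : V7 → Maybe HPoint
toHPoint v with T? (isQPoint v)
... | yes p = just (v , p)
... | no _  = nothing

allHPoints : List HPoint
allHPoints = mapMaybe toHPoint (allV 7)

p₀ : HPoint
p₀ = (true ∷ false ∷ false ∷ false ∷ false ∷ false ∷ false ∷ []) , _

IsValuation : (HPoint → ℕ) → Set
IsValuation f =
  (Σ HPoint λ y → f y ≡ 0) ×
  (∀ a b c → HLine a b c →
     (f b ≡ suc (f a) × f c ≡ suc (f a)) ⊎
     (f a ≡ suc (f b) × f c ≡ suc (f b)) ⊎
     (f a ≡ suc (f c) × f b ≡ suc (f c)))

maxVal : (HPoint → ℕ) → ℕ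
maxVal f = foldr (λ y m → f y ⊔ m) 0 allHPoints

zeroCount : (HPoint → ℕ) → ℕ
zeroCount f = length (filter (λ y → f y ≟ 0) allHPoints)

TypeA : (HPoint → ℕ) → Set
TypeA f = IsValuation f × (Σ HPoint λ p → ∀ y → IsDist HCol p y (f y))

BSize : Fin 5 → ℕ
BSize i = Data.Vec.lookup (1 ∷ 3 ∷ 4 ∷ 7 ∷ 9 ∷ []) i
  where import Data.Vec

-- Type B_{i+1}: M_f = 2 and |O_f| = 1,3,4,7,9
TypeB : Fin 5 → (HPoint → ℕ) → Set
TypeB i f = IsValuation f × maxVal f ≡ 2 × zeroCount f ≡ BSize i

TypeC : (HPoint → ℕ) → Set
TypeC f = IsValuation f × maxVal f ≡ 1

record FullIsometricH2 (G : Geometry) (N : IsNearHexagon G) : Set where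
  open Geometry G
  open IsNearHexagon N
  field
    ι : HPoint → Point
    ι-injective : ∀ a b → ι a ≡ ι b → a ≡ b
    ι-lines : ∀ a b c → HLine a b c →
              Σ Line λ L → ∀ z → On G z L ↔ ((z ≡ ι a) ⊎ (z ≡ ι b) ⊎ (z ≡ ι c))
    isometric : ∀ a b → IsDist HCol a b (d (ι a) (ι b))

module _ {G : Geometry} {N : IsNearHexagon G} (E : FullIsometricH2 G N) where
  open Geometry G
  open IsNearHexagon N
  open FullIsometricH2 E

  distH : Point → ℕ
  distH x = foldr (λ y m → d x (ι y) ⊓ m) (d x (ι p₀)) allHPoints

  fval : Point → HPoint → ℕ
  fval x y = d x (ι y) Data.Nat.∸ distH x

-- For a point x of N, f_x is a valuation of H(2): each line of H(2) is a line of
-- N by fullness, and on it the point nearest to x is unique while the other two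
-- are one step further.  Some line carries two values differing by one and the
-- diameter is 3, so d(x,H) ≤ 2.  On H itself f_x is the distance of H(2), by
-- isometry.  If d(x,H) = 2 then f_x ≤ 1 and f_x is not constant: it is ovoidal.
-- If d(x,H) = 1 then f_x ≤ 2, and two zeros of f_x are both collinear with x,
-- hence at distance at most 2 in H(2).  An exhaustive backtracking search over
-- the {0,1,2}-valued functions on the 63 points obeying the line condition shows
-- that each of them has zeros at two opposite points, has no zero, or has
-- M_f = 2 and |O_f| ∈ {1,3,4,7,9}.

module Submission where

open import Defs
open import Data.Bool using (Bool; true; false; _∧_; _∨_; _xor_; not; T)
open import Data.Bool.ListAction using (all; any)
open import Data.Bool.Properties using (T-∧; T-∨; T-≡; T-not-≡; T-irrelevant; xor-comm)
open import Data.Empty using (⊥-elim)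
open import Data.Fin using (Fin)
import Data.Fin.Properties as Fin
open import Data.List using (List; []; _∷_; map; filter; length; foldr; allFin)
open import Data.List.Membership.Propositional using (_∈_)
open import Data.List.Membership.Propositional.Properties using (∈-concatMap⁺; ∈-map⁺)
open import Data.List.Properties using (map-∘; map-cong-local; foldr-map; filter-some)
open import Data.List.Relation.Unary.All as All using (All; []; _∷_; lookupAny)
open import Data.List.Relation.Unary.All.Properties using (all⁺; all⁻)
open import Data.List.Relation.Unary.Any as Any using (Any; here; there)
open import Data.List.Relation.Unary.Any.Properties using (any⁻; gmap; mapMaybe⁺)
import Data.Maybe.Relation.Unary.Any as Maybe
open import Data.Nat
  using (ℕ; zero; suc; _≤_; _<_; _∸_; _+_; _⊓_; _⊔_; _≟_; _≡ᵇ_; _<ᵇ_; z≤n; s≤s)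
open import Data.Nat.Properties
open import Data.Product using (Σ; _×_; _,_; proj₁; proj₂)
open import Data.Sum using (_⊎_; inj₁; inj₂)
open import Data.Unit using (⊤; tt)
open import Data.Vec using (Vec; []; _∷_; zipWith; tail)
open import Data.Vec.Properties using (zipWith-comm)
open import Function using (_∘_; case_of_)
open import Function.Bundles using (Equivalence; Inverse)
open import Relation.Binary.PropositionalEquality
  using (_≡_; _≢_; refl; sym; trans; cong; subst; subst₂; ≢-sym; module ≡-Reasoning)
open import Relation.Nullary using (¬_; Dec; yes; no; does)
open import Relation.Nullary.Decidable using (T?; ¬?; _×-dec_; _⊎-dec_; dec-true)
open import Relation.Unary using (Decidable)

lookupOr : {A : Set} → A → List A → ℕ → A
lookupOr d []       _       = d
lookupOr d (x ∷ xs) zero    = x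
lookupOr d (x ∷ xs) (suc i) = lookupOr d xs i

lookupOr-map : ∀ {A B : Set} (f : A → B) {d e} xs {i} → i < length xs →
               lookupOr e (map f xs) i ≡ f (lookupOr d xs i)
lookupOr-map f (x ∷ xs) {zero}  _         = refl
lookupOr-map f (x ∷ xs) {suc i} (s≤s i<n) = lookupOr-map f xs i<n

length-filter-map : ∀ {A B : Set} {P : B → Set} (P? : Decidable P) (f : A → B) xs →
                    length (filter P? (map f xs)) ≡ length (filter (P? ∘ f) xs)
length-filter-map P? f []       = refl
length-filter-map P? f (x ∷ xs) with does (P? (f x))
... | true  = cong suc (length-filter-map P? f xs)
... | false = length-filter-map P? f xs

foldr-⊓-≤ : ∀ {A : Set} (g : A → ℕ) z xs {y} → y ∈ xs → foldr (λ y m → g y ⊓ m) z xs ≤ g y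
foldr-⊓-≤ g z (w ∷ _)  (here refl)  = m⊓n≤m (g w) _
foldr-⊓-≤ g z (w ∷ xs) (there y∈xs) = ≤-trans (m⊓n≤n (g w) _) (foldr-⊓-≤ g z xs y∈xs)

foldr-⊓-attained : ∀ {A : Set} (g : A → ℕ) y₀ xs →
                   Σ A λ y → foldr (λ y m → g y ⊓ m) (g y₀) xs ≡ g y
foldr-⊓-attained g y₀ []       = y₀ , refl
foldr-⊓-attained g y₀ (w ∷ xs) with ⊓-sel (g w) (foldr (λ y m → g y ⊓ m) (g y₀) xs)
... | inj₁ e = w , e
... | inj₂ e = let y , e′ = foldr-⊓-attained g y₀ xs in y , trans e e′

foldr-⊔-≥ : ∀ {A : Set} (g : A → ℕ) xs {y} → y ∈ xs → g y ≤ foldr (λ y m → g y ⊔ m) 0 xs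
foldr-⊔-≥ g (w ∷ _)  (here refl)  = m≤m⊔n (g w) _
foldr-⊔-≥ g (w ∷ xs) (there y∈xs) = ≤-trans (foldr-⊔-≥ g xs y∈xs) (m≤n⊔m (g w) _)

foldr-⊔-lub : ∀ {A : Set} (g : A → ℕ) {b} → (∀ y → g y ≤ b) →
              ∀ xs → foldr (λ y m → g y ⊔ m) 0 xs ≤ b
foldr-⊔-lub g g≤b []       = z≤n
foldr-⊔-lub g g≤b (y ∷ xs) = ⊔-lub (g≤b y) (foldr-⊔-lub g g≤b xs)

¬T-false : ∀ {x} → x ≡ false → ¬ T x
¬T-false refl ()

T-not⇒¬T : ∀ {x} → T (not x) → ¬ T x
T-not⇒¬T = ¬T-false ∘ Equivalence.to T-not-≡

T-does : ∀ {P : Set} (P? : Dec P) → P → T (does P?)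
T-does P? p = Equivalence.from T-≡ (dec-true P? p)

modus-ponensᵇ : ∀ {x y} → T (not x ∨ y) → T x → T y
modus-ponensᵇ {true} t _ = t

-- Walks and distances in a near polygon

module _ {A : Set} {R : A → A → Set} where

  Walk-snoc : ∀ {x y z n} → Walk R x y n → R y z → Walk R x z (suc n)
  Walk-snoc here        r′ = there r′ here
  Walk-snoc (there r w) r′ = there r (Walk-snoc w r′)

  Walk₁⇒edge : ∀ {x y} → Walk R x y 1 → R x y
  Walk₁⇒edge (there r here) = r

module NearPolygon {G : Geometry} (N : IsNearHexagon G) where
  open Geometry G
  open IsNearHexagon N

  d-≤-walk : ∀ {x y n} → Walk (Col G) x y n → d x y ≤ n
  d-≤-walk w = proj₂ (d-is-distance _ _) _ w

  d-self : ∀ x → d x x ≡ 0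
  d-self x = n≤0⇒n≡0 (d-≤-walk here)

  d-step : ∀ x {y z} → Col G y z → d x z ≤ suc (d x y)
  d-step x c = d-≤-walk (Walk-snoc (proj₁ (d-is-distance x _)) c)

  d≡1⇒Col : ∀ {x y} → d x y ≡ 1 → Col G x y
  d≡1⇒Col {x} {y} e = Walk₁⇒edge (subst (Walk (Col G) x y) e (proj₁ (d-is-distance x y)))

  Col-sym : ∀ {x y} → Col G x y → Col G y x
  Col-sym (L , x∈L , y∈L) = L , y∈L , x∈L

  common-neighbour⇒d≤2 : ∀ {x y z} → Col G x y → Col G x z → d y z ≤ 2
  common-neighbour⇒d≤2 xy xz = d-≤-walk (there (Col-sym xy) (there xz here))

  nearestOn : Point → Line → Point
  nearestOn x L = pt L (proj₁ (nearest x L))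

  d-on-line : ∀ x L {z} → On G z L → z ≡ nearestOn x L ⊎ d x z ≡ suc (d x (nearestOn x L))
  d-on-line x L (j , refl) with j Fin.≟ proj₁ (nearest x L)
  ... | yes refl = inj₁ refl
  ... | no  j≢i  = inj₂ (≤-antisym (d-step x (L , (_ , refl) , (j , refl))) (proj₂ (nearest x L) j j≢i))

-- The split Cayley hexagon H(2)

veq-refl : ∀ {n} (v : Vec Bool n) → T (veq v v)
veq-refl []          = tt
veq-refl (false ∷ v) = veq-refl v
veq-refl (true ∷ v)  = veq-refl v

veq⇒≡ : ∀ {n} {u v : Vec Bool n} → T (veq u v) → u ≡ v
veq⇒≡ {u = []}        {[]}        _ = refl
veq⇒≡ {u = false ∷ u} {false ∷ v} t = cong (false ∷_) (veq⇒≡ t)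
veq⇒≡ {u = true ∷ u}  {true ∷ v}  t = cong (true ∷_) (veq⇒≡ t)

xor-≡ˡ⇒zero : ∀ {n} (a b : Vec Bool n) → zipWith _xor_ a b ≡ a → nonzero b ≡ false
xor-≡ˡ⇒zero []          []          _  = refl
xor-≡ˡ⇒zero (_ ∷ a)     (false ∷ b) e  = xor-≡ˡ⇒zero a b (cong tail e)
xor-≡ˡ⇒zero (false ∷ a) (true ∷ b)  ()
xor-≡ˡ⇒zero (true ∷ a)  (true ∷ b)  ()

xor-≡ʳ⇒zero : ∀ {n} (a b : Vec Bool n) → zipWith _xor_ a b ≡ b → nonzero a ≡ false
xor-≡ʳ⇒zero a b e = xor-≡ˡ⇒zero b a (trans (zipWith-comm xor-comm b a) e)

HLine-sum : ∀ {a b c} → HLine a b c → proj₁ c ≡ vadd (proj₁ a) (proj₁ b)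
HLine-sum {a} {b} h =
  let _ , rest = Equivalence.to (T-∧ {not (veq (proj₁ a) (proj₁ b))}) h
  in veq⇒≡ (proj₁ (Equivalence.to T-∧ rest))

HLine-distinct : ∀ {a b c} → HLine a b c → a ≢ b × a ≢ c × b ≢ c
HLine-distinct {a , qa} {b , qb} {c , qc} h =
    (λ a≡b → T-not⇒¬T a≉b (subst (T ∘ veq a) (cong proj₁ a≡b) (veq-refl a)))
  , (λ a≡c → ¬T-false (xor-≡ˡ⇒zero a b (trans (sym c≡a+b) (sym (cong proj₁ a≡c)))) nonzero-b)
  , (λ b≡c → ¬T-false (xor-≡ʳ⇒zero a b (trans (sym c≡a+b) (sym (cong proj₁ b≡c)))) nonzero-a)
  where
    a≉b : T (not (veq a b))
    a≉b = proj₁ (Equivalence.to T-∧ h)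
    c≡a+b : c ≡ vadd a b
    c≡a+b = HLine-sum {a , qa} {b , qb} {c , qc} h
    nonzero-a : T (nonzero a)
    nonzero-a = proj₁ (Equivalence.to T-∧ qa)
    nonzero-b : T (nonzero b)
    nonzero-b = proj₁ (Equivalence.to T-∧ qb)

allV-complete : ∀ n (v : Vec Bool n) → v ∈ allV n
allV-complete zero    []      = here refl
allV-complete (suc n) (b ∷ v) = ∈-concatMap⁺ _ (Any.map (λ { refl → with-head b }) (allV-complete n v))
  where
    with-head : ∀ b → (b ∷ v) ∈ (false ∷ v) ∷ (true ∷ v) ∷ []
    with-head false = here refl
    with-head true  = there (here refl)

∈-allHPoints : ∀ y → y ∈ allHPoints
∈-allHPoints (v , q) = mapMaybe⁺ toHPoint (allV 7) (gmap found (allV-complete 7 v))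
  where
    found : ∀ {w} → v ≡ w → Maybe.Any ((v , q) ≡_) (toHPoint w)
    found refl with T? (isQPoint v)
    ... | yes q′ = Maybe.just (cong (v ,_) (T-irrelevant q q′))
    ... | no ¬q  = ⊥-elim (¬q q)

e₅ e₀₅ : HPoint
e₅  = (false ∷ false ∷ false ∷ false ∷ false ∷ true ∷ false ∷ []) , _
e₀₅ = (true ∷ false ∷ false ∷ false ∷ false ∷ true ∷ false ∷ []) , _

line-p₀e₅ : HLine p₀ e₅ e₀₅
line-p₀e₅ = _

point : ℕ → HPoint
point = lookupOr p₀ allHPoints

Opposite : HPoint → HPoint → Set
Opposite a b = ∀ n → n ≤ 2 → ¬ Walk HCol a b n

-- The third point of a line of H(2) is the sum of the other two.
collinearᵇ : HPoint → HPoint → Bool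
collinearᵇ a b = isHLine (proj₁ a) (proj₁ b) (vadd (proj₁ a) (proj₁ b))

oppositeᵇ : HPoint → HPoint → Bool
oppositeᵇ a b = not (veq (proj₁ a) (proj₁ b)) ∧ not (collinearᵇ a b)
              ∧ all (λ c → not (collinearᵇ a c ∧ collinearᵇ c b)) allHPoints

HCol⇒collinearᵇ : ∀ {a b} → HCol a b → T (collinearᵇ a b)
HCol⇒collinearᵇ {a} {b} (c , h) = subst (T ∘ isHLine (proj₁ a) (proj₁ b)) (HLine-sum {a} {b} {c} h) h

oppositeᵇ-sound : ∀ {a b} → T (oppositeᵇ a b) → Opposite a b
oppositeᵇ-sound {a} {b} t =
  let a≉b , t′   = Equivalence.to T-∧ t
      ¬ab , ¬acb = Equivalence.to T-∧ t′
  in no-short-walk a≉b ¬ab ¬acb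
  where
    no-short-walk : T (not (veq (proj₁ a) (proj₁ b))) → T (not (collinearᵇ a b)) →
                    T (all (λ c → not (collinearᵇ a c ∧ collinearᵇ c b)) allHPoints) → Opposite a b
    no-short-walk a≉a _ _ _ _ here = T-not⇒¬T a≉a (veq-refl (proj₁ a))
    no-short-walk _ ¬ab _ _ _ (there ab here) = T-not⇒¬T ¬ab (HCol⇒collinearᵇ {a} {b} ab)
    no-short-walk _ _ ¬acb _ _ (there {y = c} ac (there cb here)) =
      T-not⇒¬T (All.lookup (all⁺ (λ c → not (collinearᵇ a c ∧ collinearᵇ c b)) _ ¬acb)
                           (∈-allHPoints c))
               (Equivalence.from (T-∧ {collinearᵇ a c})
                  (HCol⇒collinearᵇ {a} {c} ac , HCol⇒collinearᵇ {c} {b} cb))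
    no-short-walk _ _ _ _ (s≤s (s≤s ())) (there _ (there _ (there _ _)))

-- Valuations and the backtracking search

LineValues : ℕ → ℕ → ℕ → Set
LineValues x y z = (y ≡ suc x × z ≡ suc x) ⊎ (x ≡ suc y × z ≡ suc y) ⊎ (x ≡ suc z × y ≡ suc z)

LineValues-∸ : ∀ {x y z} m → m ≤ x → m ≤ y → m ≤ z →
               LineValues x y z → LineValues (x ∸ m) (y ∸ m) (z ∸ m)
LineValues-∸ m m≤x _ _ (inj₁ (refl , refl)) =
  inj₁ (+-∸-assoc 1 m≤x , +-∸-assoc 1 m≤x)
LineValues-∸ m _ m≤y _ (inj₂ (inj₁ (refl , refl))) =
  inj₂ (inj₁ (+-∸-assoc 1 m≤y , +-∸-assoc 1 m≤y))
LineValues-∸ m _ _ m≤z (inj₂ (inj₂ (refl , refl))) =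
  inj₂ (inj₂ (+-∸-assoc 1 m≤z , +-∸-assoc 1 m≤z))

LineValues-rise : ∀ {A : Set} (g : A → ℕ) a b c → LineValues (g a) (g b) (g c) →
                  Σ A λ u → Σ A λ w → g w ≡ suc (g u)
LineValues-rise g a b c (inj₁ (gb≡ , _))        = a , b , gb≡
LineValues-rise g a b c (inj₂ (inj₁ (ga≡ , _))) = b , a , ga≡
LineValues-rise g a b c (inj₂ (inj₂ (ga≡ , _))) = c , a , ga≡

PairValues : ℕ → ℕ → Set
PairValues x y = y ≡ suc x ⊎ x ≡ suc y ⊎ (x ≡ y × x ≢ 0)

LineValues⇒PairValues : ∀ {x y z} → LineValues x y z → PairValues x y
LineValues⇒PairValues (inj₁ (y≡ , _))             = inj₁ y≡
LineValues⇒PairValues (inj₂ (inj₁ (x≡ , _)))      = inj₂ (inj₁ x≡)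
LineValues⇒PairValues (inj₂ (inj₂ (refl , refl))) = inj₂ (inj₂ (refl , λ ()))

lineValues? : ∀ x y z → Dec (LineValues x y z)
lineValues? x y z = ((y ≟ suc x) ×-dec (z ≟ suc x)) ⊎-dec ((x ≟ suc y) ×-dec (z ≟ suc y))
                  ⊎-dec ((x ≟ suc z) ×-dec (y ≟ suc z))

pairValues? : ∀ x y → Dec (PairValues x y)
pairValues? x y = (y ≟ suc x) ⊎-dec (x ≟ suc y) ⊎-dec ((x ≟ y) ×-dec ¬? (x ≟ 0))

-- does (lineValues? x y z) and does (pairValues? x y) unfolded; the search
-- evaluates these much faster than the decision procedures.
lineValuesᵇ : ℕ → ℕ → ℕ → Bool
lineValuesᵇ x y z = ((y ≡ᵇ suc x) ∧ (z ≡ᵇ suc x)) ∨ ((x ≡ᵇ suc y) ∧ (z ≡ᵇ suc y))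
                  ∨ ((x ≡ᵇ suc z) ∧ (y ≡ᵇ suc z))

pairValuesᵇ : ℕ → ℕ → Bool
pairValuesᵇ x y = (y ≡ᵇ suc x) ∨ (x ≡ᵇ suc y) ∨ ((x ≡ᵇ y) ∧ not (x ≡ᵇ 0))

LineValues⇒lineValuesᵇ : ∀ {x y z} → LineValues x y z → T (lineValuesᵇ x y z)
LineValues⇒lineValuesᵇ = T-does (lineValues? _ _ _)

LineValues⇒pairValuesᵇ : ∀ {x y z} → LineValues x y z → T (pairValuesᵇ x y)
LineValues⇒pairValuesᵇ = T-does (pairValues? _ _) ∘ LineValues⇒PairValues

-- A check for the point valued at step k refers to earlier points by their
-- offset o, meaning step k ∸ suc o: `closing o₁ o₂` for a line whose other
-- two points were valued earlier, `opening o s` for a line whose third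
-- point is only valued at the later step s.
data LineCheck : Set where
  closing : ℕ → ℕ → LineCheck
  opening : ℕ → ℕ → LineCheck

checkᵇ : List ℕ → ℕ → LineCheck → Bool
checkᵇ earlier v (closing o₁ o₂) = lineValuesᵇ v (lookupOr 0 earlier o₁) (lookupOr 0 earlier o₂)
checkᵇ earlier v (opening o _)   = pairValuesᵇ v (lookupOr 0 earlier o)

past : (ℕ → ℕ) → ℕ → List ℕ
past w zero    = []
past w (suc k) = w k ∷ past w k

lookupOr-past : ∀ w {k o} → o < k → lookupOr 0 (past w k) o ≡ w (k ∸ suc o)
lookupOr-past w {suc k} {zero}  _         = refl
lookupOr-past w {suc k} {suc o} (s≤s o<k) = lookupOr-past w o<k

T-∧₃-≤2 : ∀ (p : ℕ → Bool) → T (p 0 ∧ p 1 ∧ p 2) → ∀ {v} → v ≤ 2 → T (p v)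
T-∧₃-≤2 p t z≤n             = proj₁ (Equivalence.to T-∧ t)
T-∧₃-≤2 p t (s≤s z≤n)       = proj₁ (Equivalence.to T-∧ (proj₂ (Equivalence.to (T-∧ {p 0}) t)))
T-∧₃-≤2 p t (s≤s (s≤s z≤n)) = proj₂ (Equivalence.to T-∧ (proj₂ (Equivalence.to (T-∧ {p 0}) t)))

Admissible : (ℕ → ℕ) → ℕ → List (List LineCheck) → Set
Admissible w k []         = ⊤
Admissible w k (cs ∷ css) = w k ≤ 2 × All (T ∘ checkᵇ (past w k) (w k)) cs × Admissible w (suc k) css

search : (List ℕ → Bool) → List (List LineCheck) → List ℕ → Bool
search leaf []         earlier = leaf earlier
search leaf (cs ∷ css) earlier = branch 0 ∧ branch 1 ∧ branch 2
  where
    branch : ℕ → Bool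
    branch v = not (all (checkᵇ earlier v) cs) ∨ search leaf css (v ∷ earlier)

search-sound-at : ∀ leaf w css k → T (search leaf css (past w k)) → Admissible w k css →
                  T (leaf (past w (k + length css)))
search-sound-at leaf w []         k t _ = subst (λ n → T (leaf (past w n))) (sym (+-identityʳ k)) t
search-sound-at leaf w (cs ∷ css) k t (wk≤2 , checks , rest) =
  subst (λ n → T (leaf (past w n))) (sym (+-suc k (length css)))
    (search-sound-at leaf w css (suc k) (modus-ponensᵇ branch (all⁻ (checkᵇ (past w k) (w k)) checks)) rest)
  where
    branch = T-∧₃-≤2 (λ v → not (all (checkᵇ (past w k) v) cs) ∨ search leaf css (v ∷ past w k))
                     t wk≤2

search-sound : ∀ leaf w css {n} → length css ≡ n → search leaf css [] ≡ true → Admissible w 0 css →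
               T (leaf (past w n))
search-sound leaf w css refl succeeds = search-sound-at leaf w css 0 (Equivalence.from T-≡ succeeds)

-- Certificate for the search.  Step k values orderedPoint k, the point of
-- allHPoints with index lookupOr 0 searchOrder k, subject to the k-th entry of
-- lineChecks.  After the last step the value of the i-th point of allHPoints
-- sits at offset lookupOr 0 finalOffsets i of the list of values.
-- oppositePairs are indices in allHPoints of pairs of opposite points.
searchOrder : List ℕ
searchOrder =
  34 ∷ 28 ∷ 59 ∷ 9 ∷ 21 ∷ 3 ∷ 7 ∷ 44 ∷ 57 ∷ 17 ∷ 15 ∷ 11 ∷ 33 ∷ 29 ∷ 4 ∷ 18
  ∷ 55 ∷ 45 ∷ 2 ∷ 31 ∷ 1 ∷ 8 ∷ 56 ∷ 37 ∷ 5 ∷ 58 ∷ 10 ∷ 49 ∷ 14 ∷ 47 ∷ 62 ∷ 48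
  ∷ 0 ∷ 22 ∷ 32 ∷ 38 ∷ 16 ∷ 40 ∷ 36 ∷ 13 ∷ 52 ∷ 53 ∷ 26 ∷ 60 ∷ 27 ∷ 41 ∷ 19 ∷ 39
  ∷ 30 ∷ 20 ∷ 46 ∷ 25 ∷ 12 ∷ 43 ∷ 50 ∷ 54 ∷ 35 ∷ 42 ∷ 6 ∷ 23 ∷ 24 ∷ 51 ∷ 61 ∷ []

lineChecks : List (List LineCheck)
lineChecks =
    []
  ∷ (opening 0 2 ∷ [])
  ∷ (closing 1 0 ∷ [])
  ∷ (opening 1 4 ∷ [])
  ∷ (closing 2 0 ∷ [])
  ∷ (opening 1 6 ∷ [])
  ∷ (closing 2 0 ∷ [])
  ∷ (opening 2 8 ∷ [])
  ∷ (closing 3 0 ∷ [])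
  ∷ (opening 3 10 ∷ [])
  ∷ (closing 4 0 ∷ [])
  ∷ (opening 1 13 ∷ opening 3 12 ∷ [])
  ∷ (closing 4 0 ∷ [])
  ∷ (closing 3 1 ∷ [])
  ∷ (opening 3 15 ∷ opening 5 16 ∷ [])
  ∷ (closing 4 0 ∷ opening 12 17 ∷ [])
  ∷ (closing 7 1 ∷ [])
  ∷ (closing 14 1 ∷ [])
  ∷ (opening 17 19 ∷ opening 1 22 ∷ [])
  ∷ (opening 6 20 ∷ closing 18 0 ∷ [])
  ∷ (opening 13 21 ∷ closing 7 0 ∷ [])
  ∷ (closing 14 0 ∷ opening 3 23 ∷ [])
  ∷ (closing 5 3 ∷ opening 8 23 ∷ [])
  ∷ (closing 5 1 ∷ closing 9 0 ∷ [])
  ∷ (opening 17 26 ∷ opening 7 25 ∷ [])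
  ∷ (closing 8 0 ∷ [])
  ∷ (closing 19 1 ∷ [])
  ∷ (opening 2 29 ∷ opening 15 30 ∷ opening 24 28 ∷ [])
  ∷ (closing 25 0 ∷ [])
  ∷ (closing 4 1 ∷ [])
  ∷ (closing 18 2 ∷ [])
  ∷ (opening 1 32 ∷ opening 26 35 ∷ opening 7 33 ∷ [])
  ∷ (opening 21 36 ∷ opening 12 34 ∷ closing 2 0 ∷ [])
  ∷ (closing 9 1 ∷ [])
  ∷ (closing 14 1 ∷ [])
  ∷ (closing 30 3 ∷ [])
  ∷ (closing 25 3 ∷ [])
  ∷ (opening 16 47 ∷ opening 1 39 ∷ opening 8 38 ∷ [])
  ∷ (closing 9 0 ∷ opening 1 41 ∷ opening 15 48 ∷ [])
  ∷ (opening 29 44 ∷ closing 3 1 ∷ opening 13 40 ∷ [])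
  ∷ (closing 14 0 ∷ opening 5 46 ∷ opening 22 42 ∷ [])
  ∷ (opening 14 43 ∷ closing 4 2 ∷ opening 33 42 ∷ [])
  ∷ (closing 34 0 ∷ closing 24 1 ∷ [])
  ∷ (closing 16 1 ∷ opening 9 45 ∷ opening 42 44 ∷ [])
  ∷ (closing 34 4 ∷ closing 43 0 ∷ [])
  ∷ (opening 30 47 ∷ opening 14 46 ∷ closing 11 1 ∷ [])
  ∷ (opening 42 48 ∷ closing 11 5 ∷ closing 15 0 ∷ [])
  ∷ (closing 26 9 ∷ closing 32 1 ∷ [])
  ∷ (closing 44 1 ∷ closing 25 9 ∷ [])
  ∷ (opening 20 51 ∷ opening 14 61 ∷ opening 40 50 ∷ [])
  ∷ (opening 28 56 ∷ closing 41 0 ∷ opening 5 54 ∷ [])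
  ∷ (opening 45 59 ∷ opening 17 52 ∷ closing 22 1 ∷ [])
  ∷ (closing 18 0 ∷ opening 39 53 ∷ opening 26 55 ∷ [])
  ∷ (closing 40 0 ∷ opening 37 62 ∷ opening 4 54 ∷ [])
  ∷ (opening 24 58 ∷ closing 9 3 ∷ closing 5 0 ∷ [])
  ∷ (closing 29 2 ∷ opening 18 56 ∷ opening 53 57 ∷ [])
  ∷ (closing 34 5 ∷ closing 19 0 ∷ opening 25 60 ∷ [])
  ∷ (opening 9 58 ∷ closing 55 1 ∷ opening 43 61 ∷ [])
  ∷ (opening 15 59 ∷ closing 10 0 ∷ closing 28 3 ∷ [])
  ∷ (opening 40 60 ∷ closing 53 7 ∷ closing 16 0 ∷ [])
  ∷ (closing 41 0 ∷ closing 29 3 ∷ opening 24 62 ∷ [])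
  ∷ (opening 34 62 ∷ closing 26 11 ∷ closing 47 3 ∷ [])
  ∷ (closing 35 0 ∷ closing 46 8 ∷ closing 26 1 ∷ [])
  ∷ []

finalOffsets : List ℕ
finalOffsets =
  30 ∷ 42 ∷ 44 ∷ 57 ∷ 48 ∷ 38 ∷ 4 ∷ 56 ∷ 41 ∷ 59 ∷ 36 ∷ 51 ∷ 10 ∷ 23 ∷ 34 ∷ 52
  ∷ 26 ∷ 53 ∷ 47 ∷ 16 ∷ 13 ∷ 58 ∷ 29 ∷ 3 ∷ 2 ∷ 11 ∷ 20 ∷ 18 ∷ 61 ∷ 49 ∷ 14 ∷ 43
  ∷ 28 ∷ 50 ∷ 62 ∷ 6 ∷ 24 ∷ 39 ∷ 27 ∷ 15 ∷ 25 ∷ 17 ∷ 5 ∷ 9 ∷ 55 ∷ 45 ∷ 12 ∷ 33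
  ∷ 31 ∷ 35 ∷ 8 ∷ 1 ∷ 22 ∷ 21 ∷ 7 ∷ 46 ∷ 40 ∷ 54 ∷ 37 ∷ 60 ∷ 19 ∷ 0 ∷ 32 ∷ []

oppositePairs : List (ℕ × ℕ)
oppositePairs =
  (0 , 7) ∷ (0 , 8) ∷ (0 , 11) ∷ (0 , 44) ∷ (1 , 15) ∷ (1 , 16) ∷ (3 , 31)
  ∷ (7 , 11) ∷ (7 , 16) ∷ (7 , 29) ∷ (8 , 15) ∷ (8 , 17) ∷ (2 , 8) ∷ []

orderedPoint : ℕ → HPoint
orderedPoint k = point (lookupOr 0 searchOrder k)

inOrder : (HPoint → ℕ) → ℕ → ℕ
inOrder f k = f (orderedPoint k)

orderedVec : ℕ → V7
orderedVec = proj₁ ∘ orderedPoint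

validᵇ : ℕ → LineCheck → Bool
validᵇ k (closing o₁ o₂) =
  (o₁ <ᵇ k) ∧ (o₂ <ᵇ k)
  ∧ isHLine (orderedVec k) (orderedVec (k ∸ suc o₁)) (orderedVec (k ∸ suc o₂))
validᵇ k (opening o s) = (o <ᵇ k) ∧ isHLine (orderedVec k) (orderedVec (k ∸ suc o)) (orderedVec s)

allValidᵇ : ℕ → List (List LineCheck) → Bool
allValidᵇ k []         = true
allValidᵇ k (cs ∷ css) = all (validᵇ k) cs ∧ allValidᵇ (suc k) css

lineChecks-valid : allValidᵇ 0 lineChecks ≡ true
lineChecks-valid = refl

LineValued : (HPoint → ℕ) → Set
LineValued f = ∀ a b c → HLine a b c → LineValues (f a) (f b) (f c)

valid⇒check : ∀ f → LineValued f → ∀ k {c} → T (validᵇ k c) →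
              T (checkᵇ (past (inOrder f) k) (f (orderedPoint k)) c)
valid⇒check f lines k {closing o₁ o₂} t =
  let o₁<k , t′ = Equivalence.to T-∧ t
      o₂<k , h  = Equivalence.to T-∧ t′
  in LineValues⇒lineValuesᵇ (subst₂ (LineValues _)
       (sym (lookupOr-past (inOrder f) (<ᵇ⇒< o₁ k o₁<k)))
       (sym (lookupOr-past (inOrder f) (<ᵇ⇒< o₂ k o₂<k)))
       (lines (orderedPoint k) (orderedPoint (k ∸ suc o₁)) (orderedPoint (k ∸ suc o₂)) h))
valid⇒check f lines k {opening o s} t =
  let o<k , h = Equivalence.to T-∧ t
  in LineValues⇒pairValuesᵇ (subst (λ y → LineValues (f (orderedPoint k)) y (f (orderedPoint s)))
       (sym (lookupOr-past (inOrder f) (<ᵇ⇒< o k o<k)))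
       (lines (orderedPoint k) (orderedPoint (k ∸ suc o)) (orderedPoint s) h))

admissible : ∀ f → LineValued f → (∀ y → f y ≤ 2) →
             ∀ k css → allValidᵇ k css ≡ true → Admissible (inOrder f) k css
admissible f lines f≤2 k []         _ = tt
admissible f lines f≤2 k (cs ∷ css) valid =
  let cs-valid , css-valid = Equivalence.to T-∧ (Equivalence.from T-≡ valid)
  in f≤2 (orderedPoint k) , All.map (λ {c} → valid⇒check f lines k {c}) (all⁺ (validᵇ k) cs cs-valid)
   , admissible f lines f≤2 (suc k) css (Equivalence.to T-≡ css-valid)

zeros : List ℕ → ℕ
zeros vs = length (filter (_≟ 0) vs)

zeroPairᵇ : List ℕ → ℕ × ℕ → Bool
zeroPairᵇ vs (i , j) = (lookupOr 0 vs i ≡ᵇ 0) ∧ (lookupOr 0 vs j ≡ᵇ 0)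

classifiedᵇ : List ℕ → Bool
classifiedᵇ vs = any (zeroPairᵇ vs) oppositePairs ∨ (zeros vs ≡ᵇ 0)
               ∨ ((foldr _⊔_ 0 vs ≡ᵇ 2) ∧ any (λ i → zeros vs ≡ᵇ BSize i) (allFin 5))

leafᵇ : List ℕ → Bool
leafᵇ earlier = classifiedᵇ (map (lookupOr 0 earlier) finalOffsets)

search-succeeds : search leafᵇ lineChecks [] ≡ true
search-succeeds = refl

finalOffsets<63 : All (_< 63) finalOffsets
finalOffsets<63 = All.map (λ {o} → <ᵇ⇒< o 63) (all⁺ (_<ᵇ 63) finalOffsets tt)

finalOffsets-enumerate : map (λ o → orderedPoint (63 ∸ suc o)) finalOffsets ≡ allHPoints
finalOffsets-enumerate = refl

final-values : ∀ f → map (lookupOr 0 (past (inOrder f) 63)) finalOffsets ≡ map f allHPoints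
final-values f = begin
    map (lookupOr 0 (past (inOrder f) 63)) finalOffsets
  ≡⟨ map-cong-local {f = lookupOr 0 (past (inOrder f) 63)} {g = λ o → f (orderedPoint (63 ∸ suc o))}
       {xs = finalOffsets}
       (All.map (lookupOr-past (inOrder f)) finalOffsets<63) ⟩
    map (λ o → f (orderedPoint (63 ∸ suc o))) finalOffsets
  ≡⟨ map-∘ {g = f} {f = λ o → orderedPoint (63 ∸ suc o)} finalOffsets ⟩
    map f (map (λ o → orderedPoint (63 ∸ suc o)) finalOffsets)
  ≡⟨ cong (map f) {x = map (λ o → orderedPoint (63 ∸ suc o)) finalOffsets} {y = allHPoints}
       finalOffsets-enumerate ⟩
    map f allHPoints
  ∎
  where open ≡-Reasoning

classified-values : ∀ f → LineValued f → (∀ y → f y ≤ 2) → T (classifiedᵇ (map f allHPoints))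
classified-values f lines f≤2 = subst (λ vs → T (classifiedᵇ vs)) (final-values f) reached
  where
    reached : T (leafᵇ (past (inOrder f) 63))
    reached = search-sound leafᵇ (inOrder f) lineChecks {63} refl search-succeeds
                (admissible f lines f≤2 0 lineChecks lineChecks-valid)

OppositeZeros : (HPoint → ℕ) → Set
OppositeZeros f = Σ HPoint λ a → Σ HPoint λ b → Opposite a b × f a ≡ 0 × f b ≡ 0

oppositeIndicesᵇ : ℕ × ℕ → Bool
oppositeIndicesᵇ (i , j) = (i <ᵇ 63) ∧ (j <ᵇ 63) ∧ oppositeᵇ (point i) (point j)

oppositePairs-opposite : All (T ∘ oppositeIndicesᵇ) oppositePairs
oppositePairs-opposite = all⁺ oppositeIndicesᵇ oppositePairs tt

zeroPairᵇ-sound : ∀ vs i j → T (zeroPairᵇ vs (i , j)) → lookupOr 0 vs i ≡ 0 × lookupOr 0 vs j ≡ 0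
zeroPairᵇ-sound vs i j t =
  let vᵢ≡0 , vⱼ≡0 = Equivalence.to T-∧ t in ≡ᵇ⇒≡ _ 0 vᵢ≡0 , ≡ᵇ⇒≡ _ 0 vⱼ≡0

opposite-zeros : ∀ f → T (any (zeroPairᵇ (map f allHPoints)) oppositePairs) → OppositeZeros f
opposite-zeros f t =
  let some-pair   = any⁻ (zeroPairᵇ (map f allHPoints)) oppositePairs t
      valid , zs  = lookupAny oppositePairs-opposite some-pair
  in at (Any.lookup some-pair) valid zs
  where
    zero-at : ∀ i → T (i <ᵇ 63) → lookupOr 0 (map f allHPoints) i ≡ 0 → f (point i) ≡ 0
    zero-at i i<63 fi≡0 = trans (sym (lookupOr-map f allHPoints (<ᵇ⇒< i 63 i<63))) fi≡0

    at : ∀ p → T (oppositeIndicesᵇ p) → T (zeroPairᵇ (map f allHPoints) p) → OppositeZeros f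
    at (i , j) valid zs =
      let i<63 , valid′ = Equivalence.to (T-∧ {i <ᵇ 63}) valid
          j<63 , opp    = Equivalence.to (T-∧ {j <ᵇ 63}) valid′
          fi≡0 , fj≡0   = zeroPairᵇ-sound (map f allHPoints) i j zs
      in point i , point j , oppositeᵇ-sound {point i} {point j} opp
       , zero-at i i<63 fi≡0 , zero-at j j<63 fj≡0

zeros-map : ∀ f → zeros (map f allHPoints) ≡ zeroCount f
zeros-map f = length-filter-map (_≟ 0) f allHPoints

valuation≤2-classification : ∀ f → IsValuation f → (∀ y → f y ≤ 2) →
  OppositeZeros f ⊎ Σ (Fin 5) λ i → maxVal f ≡ 2 × zeroCount f ≡ BSize i
valuation≤2-classification f ((y₀ , fy₀≡0) , lines) f≤2 =
  case Equivalence.to T-∨ (classified-values f lines f≤2) of λ where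
    (inj₁ opposite) → inj₁ (opposite-zeros f opposite)
    (inj₂ rest) → case Equivalence.to T-∨ rest of λ where
      (inj₁ no-zero) → ⊥-elim (<⇒≢ some-zero (sym (≡ᵇ⇒≡ _ 0 no-zero)))
      (inj₂ params)  →
        let max≡2 , size = Equivalence.to T-∧ params
            i , zeros≡    = Any.satisfied
                              (any⁻ (λ i → zeros (map f allHPoints) ≡ᵇ BSize i) (allFin 5) size)
        in inj₂ (i , trans (sym (foldr-map _⊔_ f 0 allHPoints)) (≡ᵇ⇒≡ _ 2 max≡2)
                   , trans (sym (zeros-map f)) (≡ᵇ⇒≡ _ _ zeros≡))
  where
    some-zero : 0 < zeros (map f allHPoints)
    some-zero = filter-some (_≟ 0)
      (Any.map (λ fy₀≡v → trans (sym fy₀≡v) fy₀≡0) (∈-map⁺ f (∈-allHPoints y₀)))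

-- The valuation induced by a point of the near hexagon

module Embedding {G : Geometry} {N : IsNearHexagon G} (E : FullIsometricH2 G N) where
  open Geometry G
  open IsNearHexagon N
  open FullIsometricH2 E
  open NearPolygon N

  d-LineValues : ∀ x a b c → HLine a b c → LineValues (d x (ι a)) (d x (ι b)) (d x (ι c))
  d-LineValues x a b c h with ι-lines a b c h
  ... | L , on-L⇔ = case Inverse.to (on-L⇔ p) (proj₁ (nearest x L) , refl) of λ where
      (inj₁ p≡a) → inj₁
        (one-further p≡a a≢b a≢c (on-L (inj₂ (inj₁ refl))) (on-L (inj₂ (inj₂ refl))))
      (inj₂ (inj₁ p≡b)) → inj₂ (inj₁
        (one-further p≡b (≢-sym a≢b) b≢c (on-L (inj₁ refl)) (on-L (inj₂ (inj₂ refl)))))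
      (inj₂ (inj₂ p≡c)) → inj₂ (inj₂
        (one-further p≡c (≢-sym a≢c) (≢-sym b≢c) (on-L (inj₁ refl)) (on-L (inj₂ (inj₁ refl)))))
    where
      p = nearestOn x L
      a≢b = proj₁ (HLine-distinct {a} {b} {c} h)
      a≢c = proj₁ (proj₂ (HLine-distinct {a} {b} {c} h))
      b≢c = proj₂ (proj₂ (HLine-distinct {a} {b} {c} h))

      on-L : ∀ {z} → z ≡ ι a ⊎ z ≡ ι b ⊎ z ≡ ι c → On G z L
      on-L = Inverse.from (on-L⇔ _)

      one-further : ∀ {u v w} → p ≡ ι u → u ≢ v → u ≢ w → On G (ι v) L → On G (ι w) L →
                    d x (ι v) ≡ suc (d x (ι u)) × d x (ι w) ≡ suc (d x (ι u))
      one-further {u} p≡u u≢v u≢w v∈L w∈L = further v∈L u≢v , further w∈L u≢w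
        where
          further : ∀ {y} → On G (ι y) L → u ≢ y → d x (ι y) ≡ suc (d x (ι u))
          further {y} y∈L u≢y with d-on-line x L y∈L
          ... | inj₁ y≡p = ⊥-elim (u≢y (ι-injective u y (trans (sym p≡u) (sym y≡p))))
          ... | inj₂ e   = subst (λ z → d x (ι y) ≡ suc (d x z)) p≡u e

  distH-≤ : ∀ x y → distH E x ≤ d x (ι y)
  distH-≤ x y = foldr-⊓-≤ (λ y → d x (ι y)) _ allHPoints (∈-allHPoints y)

  distH-attained : ∀ x → Σ HPoint λ y → distH E x ≡ d x (ι y)
  distH-attained x = foldr-⊓-attained (λ y → d x (ι y)) p₀ allHPoints

  fval-valuation : ∀ x → IsValuation (fval E x)
  fval-valuation x = has-zero , lines
    where
      has-zero : Σ HPoint λ y → fval E x y ≡ 0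
      has-zero = let y , e = distH-attained x
                 in y , subst (λ m → d x (ι y) ∸ m ≡ 0) (sym e) (n∸n≡0 (d x (ι y)))
      lines : LineValued (fval E x)
      lines a b c h = LineValues-∸ (distH E x) (distH-≤ x a) (distH-≤ x b) (distH-≤ x c)
                                   (d-LineValues x a b c h)

  fval-≤ : ∀ x y → fval E x y ≤ 3 ∸ distH E x
  fval-≤ x y = ∸-monoˡ-≤ (distH E x) (diam-≤3 x (ι y))

  fval-zero⇒Col : ∀ {x y} → distH E x ≡ 1 → fval E x y ≡ 0 → Col G x (ι y)
  fval-zero⇒Col {x} {y} dH≡1 fy≡0 = d≡1⇒Col (≤-antisym
    (subst (d x (ι y) ≤_) dH≡1 (m∸n≡0⇒m≤n fy≡0))
    (subst (_≤ d x (ι y)) dH≡1 (distH-≤ x y)))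

  distH-≤2 : ∀ x → distH E x ≤ 2
  distH-≤2 x =
    let u , w , rise = LineValues-rise (λ y → d x (ι y)) p₀ e₅ e₀₅
                                       (d-LineValues x p₀ e₅ e₀₅ line-p₀e₅)
    in ≤-pred (≤-trans (s≤s (distH-≤ x u)) (subst (_≤ 3) rise (diam-≤3 x (ι w))))

  ι-TypeA : ∀ y → TypeA (fval E (ι y))
  ι-TypeA y = fval-valuation (ι y) , y , λ z → subst (IsDist HCol y z) (sym (fval-ι z)) (isometric y z)
    where
      distH-ι : distH E (ι y) ≡ 0
      distH-ι = n≤0⇒n≡0 (subst (distH E (ι y) ≤_) (d-self (ι y)) (distH-≤ (ι y) y))
      fval-ι : ∀ z → fval E (ι y) z ≡ d (ι y) (ι z)
      fval-ι z = cong (d (ι y) (ι z) ∸_) distH-ι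

  distH≡1⇒TypeB : ∀ x → distH E x ≡ 1 → Σ (Fin 5) λ i → TypeB i (fval E x)
  distH≡1⇒TypeB x dH≡1 =
    case valuation≤2-classification (fval E x) (fval-valuation x) fval≤2 of λ where
      (inj₁ (a , b , opposite , fa≡0 , fb≡0)) → ⊥-elim (opposite _
          (common-neighbour⇒d≤2 (fval-zero⇒Col dH≡1 fa≡0) (fval-zero⇒Col dH≡1 fb≡0))
          (proj₁ (isometric a b)))
      (inj₂ (i , max≡2 , size)) → i , fval-valuation x , max≡2 , size
    where
      fval≤2 : ∀ y → fval E x y ≤ 2
      fval≤2 y = subst (λ m → fval E x y ≤ 3 ∸ m) dH≡1 (fval-≤ x y)

  distH≡2⇒TypeC : ∀ x → distH E x ≡ 2 → TypeC (fval E x)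
  distH≡2⇒TypeC x dH≡2 = fval-valuation x , ≤-antisym (foldr-⊔-lub f fval≤1 allHPoints) 1≤maxVal
    where
      f = fval E x
      fval≤1 : ∀ y → f y ≤ 1
      fval≤1 y = subst (λ m → f y ≤ 3 ∸ m) dH≡2 (fval-≤ x y)
      1≤maxVal : 1 ≤ maxVal f
      1≤maxVal =
        let u , w , rise = LineValues-rise f p₀ e₅ e₀₅
                                           (proj₂ (fval-valuation x) p₀ e₅ e₀₅ line-p₀e₅)
        in ≤-trans (subst (1 ≤_) (sym rise) (s≤s z≤n)) (foldr-⊔-≥ f allHPoints (∈-allHPoints w))

lemma4p2 : (G : Geometry) (N : IsNearHexagon G) (E : FullIsometricH2 G N) →
    (∀ x → distH E x ≤ 2) ×
    (∀ y → TypeA (fval E (FullIsometricH2.ι E y))) ×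
    (∀ x → distH E x ≡ 1 → Σ (Fin 5) λ i → TypeB i (fval E x)) ×
    (∀ x → distH E x ≡ 2 → TypeC (fval E x))
lemma4p2 G N E = distH-≤2 , ι-TypeA , distH≡1⇒TypeB , distH≡2⇒TypeC
  where open Embedding E
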